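{- Let $S\neq\emptyset$ be a finite closed subset of $\mathcal{M}$ (in the mutation class topology). Then every $[P]\in S$ is mutation-finite, i.e., the mutation class $[P]$ contains only finitely many quivers (up to isomorphism).
   Context: A quiver is a finite directed multigraph (with at least one vertex) without loops and without oriented 2-cycles, with vertices labeled $1,\dots,n$. For a vertex $k$, the mutation $\mu_k(Q)$ is obtained by: (1) for each oriented path $i\to k\to j$ adding an arrow $i\to j$; (2) reversing all arrows incident to $k$; (3) removing a maximal collection of pairwise-disjoint oriented 2-cycles created. Two quivers are mutation-equivalent if one is isomorphic to a quiver obtained from the other by a finite sequence of mutations; the mutation class $[Q]$ is the equivalence class of $Q$. For $I\subseteq[n]$, the full subquiver $Q_I$ has vertex set $I$ and all arrows of $Q$ between vertices of $I$. A mutation class $[P]$ embeds into $[Q]$, written $[P]\preceq[Q]$, if some $P'\in[P]$ is isomorphic to a full subquiver of some $Q'\in[Q]$; this is a partial order on the set $\mathcal{M}$ of all mutation classes. The mutation class topology on $\mathcal{M}$ is the Alexandrov topology of $\preceq$: a set $S$ is closed iff whenever $[Q]\in S$ and $[P]\preceq[Q]$ we have $[P]\in S$. -}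

module Defs where

open import Data.Nat using (ℕ; _+_; _*_; _∸_; _≤_)
open import Data.Fin using (Fin; _≟_)
open import Data.List using (List; []; _∷_)
open import Data.List.Relation.Unary.Any using (Any)
open import Data.Product using (Σ; ∃; _×_)
open import Data.Sum using (_⊎_)
open import Relation.Nullary using (yes; no)
open import Relation.Binary.PropositionalEquality using (_≡_)
open import Function.Bundles using (_↔_; Inverse)
open import Function.Definitions using (Injective)

-- Arrow-count data on vertex set Fin n: arr i j = number of arrows i → j.
Arr : ℕ → Set
Arr n = Fin n → Fin n → ℕ

record Quiver : Set where
  field
    n        : ℕ
    nonempty : 1 ≤ n
    arr      : Arr n
    noLoop   : ∀ i → arr i i ≡ 0
    no2cycle : ∀ i j → arr i j ≡ 0 ⊎ arr j i ≡ 0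
open Quiver public

-- Mutation at k (on arrow counts):
--  arrows incident to k are reversed; for i, j ≠ k, arrows i→j get a i k * a k j
--  new ones, and the resulting 2-cycles between i and j are cancelled.
μ : ∀ {n} → Fin n → Arr n → Arr n
μ k a i j with i ≟ k | j ≟ k
... | yes _ | _     = a j i
... | no _  | yes _ = a j i
... | no _  | no _  = (a i j + a i k * a k j) ∸ (a j i + a j k * a k i)

μs : ∀ {n} → List (Fin n) → Arr n → Arr n
μs []       a = a
μs (k ∷ ks) a = μs ks (μ k a)

Iso : ∀ {n m} → Arr n → Arr m → Set
Iso {n} {m} a b = Σ (Fin n ↔ Fin m) λ σ →
  ∀ i j → a i j ≡ b (Inverse.to σ i) (Inverse.to σ j)

MutEq : Quiver → Quiver → Set
MutEq P Q = ∃ λ (ks : List (Fin (n P))) → Iso (μs ks (arr P)) (arr Q)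

FullSub : Quiver → Quiver → Set
FullSub P Q = ∃ λ (ι : Fin (n P) → Fin (n Q)) →
  Injective _≡_ _≡_ ι × (∀ i j → arr P i j ≡ arr Q (ι i) (ι j))

Embeds : Quiver → Quiver → Set
Embeds P Q = ∃ λ P' → ∃ λ Q' → MutEq P P' × MutEq Q Q' × FullSub P' Q'

-- Subsets of the set 𝓜 of mutation classes are modelled as predicates on
-- quivers that are invariant under mutation equivalence.
ClassPred : (Quiver → Set) → Set
ClassPred S = ∀ P Q → S P → MutEq P Q → S Q

-- Closed in the mutation class (Alexandrov) topology: downward closed under ≼.
Closed : (Quiver → Set) → Set
Closed S = ∀ P Q → S Q → Embeds P Q → S P

FiniteClasses : (Quiver → Set) → Set
FiniteClasses S = ∃ λ (L : List Quiver) → ∀ Q → S Q → Any (λ R → MutEq R Q) L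

MutationFinite : Quiver → Set
MutationFinite P = ∃ λ (L : List Quiver) →
  ∀ Q → MutEq P Q → Any (λ R → Iso (arr R) (arr Q)) L

{-# OPTIONS --safe #-}
-- If [P] lies in the closed set S, so does every Kronecker quiver K_m (two
-- vertices, m arrows) embedded in a quiver of [P].  A quiver mutation-
-- equivalent to K_m has two vertices, where mutation only reverses arrows, so
-- it has an arrow pair of multiplicity at least m.  As S meets only finitely
-- many classes, this bounds m, hence bounds every arrow multiplicity in [P];
-- and there are only finitely many quivers with n vertices and bounded
-- multiplicities.
module Submission where

open import Defs
open import Data.Empty using (⊥-elim)
open import Data.Fin using (Fin; zero; suc; _≟_)
open import Data.Fin.Patterns using (0F; 1F)
open import Data.List using (List; []; _∷_; map; cartesianProductWith; allFin; upTo)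
open import Data.List.Extrema.Nat using (max; v≤max⁺)
open import Data.List.Membership.Propositional.Properties
  using (∈-allFin; ∈-cartesianProductWith⁺; ∈-upTo⁺)
open import Data.List.Relation.Unary.Any as Any using (Any; here)
open import Data.List.Relation.Unary.Any.Properties using (map⁺; cartesianProductWith⁺)
open import Data.Nat using (ℕ; zero; suc; _+_; _*_; _∸_; _≤_; z≤n; s≤s)
open import Data.Nat.Properties
  using (≤-refl; ≤-reflexive; ≤-trans; ≤-total; n∸n≡0; 0∸n≡0; m≤n⇒m∸n≡0; module ≤-Reasoning)
open import Data.Product using (∃; _,_)
open import Data.Sum using (_⊎_; inj₁; inj₂; [_,_]′)
open import Data.Vec.Functional using (Vector) renaming ([] to []ᶠ; _∷_ to _∷ᶠ_)
open import Function using (_∘_; _↣_; Injection)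
open import Function.Bundles using (_↔_; Inverse)
open import Function.Properties.Inverse using (↔-refl; ↔⇒↣)
open import Relation.Nullary using (yes; no)
open import Relation.Binary.PropositionalEquality using (_≡_; _≢_; refl; sym; cong₂; module ≡-Reasoning)

functions : {A : Set} (k : ℕ) → List A → List (Vector A k)
functions zero    xs = []ᶠ ∷ []
functions (suc k) xs = cartesianProductWith _∷ᶠ_ xs (functions k xs)

functions⁺ : ∀ {A : Set} {k} {P : Fin k → A → Set} {xs : List A} →
             (∀ i → Any (P i) xs) → Any (λ f → ∀ i → P i (f i)) (functions k xs)
functions⁺ {k = zero}  _  = here λ ()
functions⁺ {k = suc k} px = cartesianProductWith⁺ _∷ᶠ_
  (λ p q → λ { zero → p ; (suc i) → q i }) (px zero) (functions⁺ (px ∘ suc))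

maxArrow : Quiver → ℕ
maxArrow Q = max 0 (cartesianProductWith (arr Q) (allFin (n Q)) (allFin (n Q)))

arr≤maxArrow : ∀ Q i j → arr Q i j ≤ maxArrow Q
arr≤maxArrow Q i j = v≤max⁺ 0 _
  (inj₂ (Any.map ≤-reflexive (∈-cartesianProductWith⁺ (arr Q) (∈-allFin i) (∈-allFin j))))

AtMostTwo : Set → Set
AtMostTwo A = ∀ {c x y : A} → x ≢ c → y ≢ c → x ≡ y

Fin2-atMostTwo : AtMostTwo (Fin 2)
Fin2-atMostTwo {0F} {0F}      x≢c _   = ⊥-elim (x≢c refl)
Fin2-atMostTwo {0F} {1F} {0F} _   y≢c = ⊥-elim (y≢c refl)
Fin2-atMostTwo {0F} {1F} {1F} _   _   = refl
Fin2-atMostTwo {1F} {1F}      x≢c _   = ⊥-elim (x≢c refl)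
Fin2-atMostTwo {1F} {0F} {1F} _   y≢c = ⊥-elim (y≢c refl)
Fin2-atMostTwo {1F} {0F} {0F} _   _   = refl

↣-reflects-atMostTwo : ∀ {A B : Set} → A ↣ B → AtMostTwo B → AtMostTwo A
↣-reflects-atMostTwo f atMostTwo x≢c y≢c =
  injective (atMostTwo (x≢c ∘ injective) (y≢c ∘ injective))
  where open Injection f

-- The only pair of vertices avoiding c is a diagonal one, which mutation clears.
μ-atMostTwo : ∀ {k} → AtMostTwo (Fin k) → ∀ c (a : Arr k) i j → μ c a i j ≤ a j i
μ-atMostTwo atMostTwo c a i j with i ≟ c | j ≟ c
... | yes _   | _       = ≤-refl
... | no _    | yes _   = ≤-refl
... | no i≢c  | no j≢c  with atMostTwo i≢c j≢c
... | refl = ≤-trans (≤-reflexive (n∸n≡0 (a i i + a i c * a c i))) z≤n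

μs-bounded : ∀ {k} → AtMostTwo (Fin k) → ∀ ks {a : Arr k} {B} →
             (∀ i j → a i j ≤ B) → ∀ i j → μs ks a i j ≤ B
μs-bounded atMostTwo []       a≤B = a≤B
μs-bounded atMostTwo (c ∷ ks) {a} a≤B = μs-bounded atMostTwo ks
  λ i j → ≤-trans (μ-atMostTwo atMostTwo c a i j) (a≤B j i)

kronecker : ℕ → Quiver
kronecker m = record
  { n = 2 ; nonempty = s≤s z≤n ; arr = arrows ; noLoop = noLoop′ ; no2cycle = no2cycle′ }
  where
  arrows : Arr 2
  arrows 0F 1F = m
  arrows _  _  = 0
  noLoop′ : ∀ i → arrows i i ≡ 0
  noLoop′ 0F = refl
  noLoop′ 1F = refl
  no2cycle′ : ∀ i j → arrows i j ≡ 0 ⊎ arrows j i ≡ 0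
  no2cycle′ 0F 0F = inj₁ refl
  no2cycle′ 0F 1F = inj₂ refl
  no2cycle′ 1F _  = inj₁ refl

mutEq-kronecker⇒≤maxArrow : ∀ {m} R → MutEq R (kronecker m) → m ≤ maxArrow R
mutEq-kronecker⇒≤maxArrow {m} R (ks , σ , μs≡) = begin
  m                                ≡⟨ cong₂ (arr (kronecker m)) (strictlyInverseˡ 0F) (strictlyInverseˡ 1F) ⟨
  arr (kronecker m) (to x) (to y)  ≡⟨ μs≡ x y ⟨
  μs ks (arr R) x y                ≤⟨ μs-bounded atMostTwo ks (arr≤maxArrow R) x y ⟩
  maxArrow R                       ∎
  where
  open Inverse σ
  open ≤-Reasoning
  x y : Fin (n R)
  x = from 0F
  y = from 1F
  atMostTwo : AtMostTwo (Fin (n R))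
  atMostTwo = ↣-reflects-atMostTwo (↔⇒↣ σ) Fin2-atMostTwo

kronecker-fullSub : ∀ Q {i j} → i ≢ j → arr Q j i ≡ 0 → FullSub (kronecker (arr Q i j)) Q
kronecker-fullSub Q {i} {j} i≢j aji≡0 = ι , ι-injective , preserves
  where
  ι : Vector (Fin (n Q)) 2
  ι = i ∷ᶠ j ∷ᶠ []ᶠ
  ι-injective : ∀ {x y} → ι x ≡ ι y → x ≡ y
  ι-injective {0F} {0F} _ = refl
  ι-injective {0F} {1F} e = ⊥-elim (i≢j e)
  ι-injective {1F} {0F} e = ⊥-elim (i≢j (sym e))
  ι-injective {1F} {1F} _ = refl
  preserves : ∀ x y → arr (kronecker (arr Q i j)) x y ≡ arr Q (ι x) (ι y)
  preserves 0F 0F = sym (noLoop Q i)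
  preserves 0F 1F = refl
  preserves 1F 0F = sym aji≡0
  preserves 1F 1F = sym (noLoop Q j)

kronecker-bounded⇒arr-bounded : ∀ Q {M} → (∀ m → FullSub (kronecker m) Q → m ≤ M) →
                                ∀ i j → arr Q i j ≤ M
kronecker-bounded⇒arr-bounded Q K≤M i j with i ≟ j | no2cycle Q i j
... | yes refl | _          rewrite noLoop Q i = z≤n
... | no _     | inj₁ aij≡0 rewrite aij≡0      = z≤n
... | no i≢j   | inj₂ aji≡0 = K≤M _ (kronecker-fullSub Q i≢j aji≡0)

antisymmetrise : ∀ {k} → Arr k → Arr k
antisymmetrise a i j = a i j ∸ a j i

antisymmetrise-no2cycle : ∀ {k} {a : Arr k} → (∀ i j → a i j ≡ 0 ⊎ a j i ≡ 0) →
                          ∀ i j → antisymmetrise a i j ≡ a i j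
antisymmetrise-no2cycle {a = a} no2 i j with no2 i j
... | inj₁ aij≡0 rewrite aij≡0 = 0∸n≡0 (a j i)
... | inj₂ aji≡0 rewrite aji≡0 = refl

antisymmetrised : ∀ {k} → 1 ≤ k → Arr k → Quiver
antisymmetrised {k} 1≤k a = record
  { n        = k
  ; nonempty = 1≤k
  ; arr      = antisymmetrise a
  ; noLoop   = λ i → n∸n≡0 (a i i)
  ; no2cycle = λ i j → [ inj₁ ∘ m≤n⇒m∸n≡0 , inj₂ ∘ m≤n⇒m∸n≡0 ]′ (≤-total (a i j) (a j i))
  }

quivers≤ : ∀ {k} → 1 ≤ k → ℕ → List Quiver
quivers≤ {k} 1≤k M = map (antisymmetrised 1≤k) (functions k (functions k (upTo (suc M))))

quivers≤-complete : ∀ {k} (1≤k : 1 ≤ k) M Q → Fin k ↔ Fin (n Q) → (∀ i j → arr Q i j ≤ M) →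
                    Any (λ R → Iso (arr R) (arr Q)) (quivers≤ 1≤k M)
quivers≤-complete {k} 1≤k M Q σ arr≤M =
  map⁺ (Any.map iso (functions⁺ λ i → functions⁺ λ j → ∈-upTo⁺ (s≤s (arr≤M (to i) (to j)))))
  where
  open Inverse σ
  a : Arr k
  a i j = arr Q (to i) (to j)
  iso : ∀ {g : Arr k} → (∀ i j → a i j ≡ g i j) → Iso (antisymmetrise g) (arr Q)
  iso {g} a≡g = σ , λ i j → begin
    g i j ∸ g j i  ≡⟨ cong₂ _∸_ (a≡g i j) (a≡g j i) ⟨
    a i j ∸ a j i  ≡⟨ antisymmetrise-no2cycle (λ i j → no2cycle Q (to i) (to j)) i j ⟩
    a i j          ∎
    where open ≡-Reasoning

maxArrowOf : List Quiver → ℕ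
maxArrowOf L = max 0 (map maxArrow L)

listed-kronecker⇒≤maxArrowOf : ∀ {m} L → Any (λ R → MutEq R (kronecker m)) L → m ≤ maxArrowOf L
listed-kronecker⇒≤maxArrowOf L K∈L =
  v≤max⁺ 0 (map maxArrow L) (inj₂ (map⁺ (Any.map (λ {R} → mutEq-kronecker⇒≤maxArrow R) K∈L)))

lemma3p10 : (S : Quiver → Set) → ClassPred S → Closed S → FiniteClasses S →
    ∃ S → ∀ P → S P → MutationFinite P
lemma3p10 S _ closed (L , classesOf) _ P SP =
  quivers≤ (nonempty P) (maxArrowOf L) , λ Q P~Q@(_ , σ , _) →
    quivers≤-complete (nonempty P) (maxArrowOf L) Q σ
      (kronecker-bounded⇒arr-bounded Q (kronecker≤ Q P~Q))
  where
  kronecker≤ : ∀ Q → MutEq P Q → ∀ m → FullSub (kronecker m) Q → m ≤ maxArrowOf L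
  kronecker≤ Q P~Q m K⊆Q = listed-kronecker⇒≤maxArrowOf L (classesOf (kronecker m) K∈S)
    where
    K∈S : S (kronecker m)
    K∈S = closed (kronecker m) P SP (kronecker m , Q , ([] , ↔-refl , λ _ _ → refl) , P~Q , K⊆Q)
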